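{- The set \[\mathcal{A}=\{\alpha z_k:\ \alpha \text{ is a finite word in } a_1,\dots,a_r,\ k>1 \text{ an odd integer}\}\] is dense in $\mathscr{G}$.
   Context: $T$ is the rooted binary tree of finite words over $X=\{0,1\}$, $\Omega=\mathrm{Aut}(T)$ with its profinite topology (neighbourhood basis of the identity: kernels of the restrictions to the finite subtrees $T_n$), acting on the right. Each $\alpha\in\Omega$ is uniquely $(\alpha_0,\alpha_1)\tau$, $\tau\in\{\mathrm{id},\sigma\}$, meaning $(xv)\alpha=(x)\tau\,(v)\alpha_x$. Powers $\alpha^m$, $m\in\mathbb{Z}_2$, are $2$-adic limits. Standard odometer $\gamma=(\gamma,\mathrm{id})\sigma$; for $k\in\mathbb{Z}_2^\times$, $\ell=(k-1)/2$ and $z_k=(z_k,\gamma^\ell z_k)$ recursively. $N(\gamma)=\{\gamma^m z_k: m\in\mathbb{Z}_2,k\in\mathbb{Z}_2^\times\}$. Fix $r\ge2$; $a_1=(a_r,\mathrm{id})\sigma$, $a_i=(a_{i-1},\mathrm{id})$ for $2\le i\le r$; $G$ is the closure of the subgroup generated by $a_1,\dots,a_r$, and $\mathscr{G}=\{gh: g\in G, h\in N(\gamma)\}$, a subgroup of $\Omega$. -}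

module Defs where

open import Data.Nat using (ℕ; zero; suc; _+_; _*_; _^_; _≤_; _/_; _%_; _≡ᵇ_)
open import Data.Bool using (Bool; true; false; _xor_; if_then_else_)
open import Data.Fin using (Fin; zero; suc; fromℕ; inject₁)
open import Data.Vec using (Vec; []; _∷_)
open import Data.List using (List; foldr)
open import Data.Sum using (_⊎_; inj₁; inj₂)
open import Data.Product using (Σ; ∃; _×_; _,_)
open import Relation.Binary.PropositionalEquality using (_≡_)

-- Letters: X = {0,1} is Bool with false = 0, true = 1.
-- An automorphism of T is represented by its portrait: the label τ ∈ {id,σ}
-- (false = id, true = σ) at every vertex (finite word) of T.  This is the
-- wreath recursion α = (α₀,α₁)τ: label at [] is τ, labels below x are
-- those of the section α_x.
Ω : Set
Ω = (n : ℕ) → Vec Bool n → Bool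

sec : Ω → Bool → Ω
sec p x n v = p (suc n) (x ∷ v)

act : Ω → ∀ {n} → Vec Bool n → Vec Bool n
act p [] = []
act p (x ∷ v) = (x xor p 0 []) ∷ act (sec p x) v

_≈_ : Ω → Ω → Set
p ≈ q = ∀ n (v : Vec Bool n) → p n v ≡ q n v

e : Ω
e _ _ = false

-- product with right action: w(αβ) = (wα)β
_·_ : Ω → Ω → Ω
(p · q) n v = p n v xor q n (act p v)

infixl 7 _·_

-- inverse: α⁻¹ = (α_{(0)τ}⁻¹, α_{(1)τ}⁻¹)τ
inv : Ω → Ω
inv p zero [] = p 0 []
inv p (suc n) (y ∷ u) = inv (sec p (y xor p 0 [])) n u

pow : Ω → ℕ → Ω
pow p zero = e
pow p (suc j) = p · pow p j

-- 2-adic integers as digit streams m = Σ m(i) 2^i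
ℤ₂ : Set
ℤ₂ = ℕ → Bool

trunc : ℤ₂ → ℕ → ℕ
trunc m zero = 0
trunc m (suc n) = trunc m n + (if m n then 2 ^ n else 0)

toℤ₂ : ℕ → ℤ₂
toℤ₂ l zero = (l % 2) ≡ᵇ 1
toℤ₂ l (suc i) = toℤ₂ (l / 2) i

-- 2-adic power α^m = lim α^(m mod 2^N).  The label at a vertex of length n
-- only depends on the action on T_{n+1}, where α has order dividing 2^(n+1),
-- so it is the label of α^(m mod 2^(n+1)).
pow₂ : Ω → ℤ₂ → Ω
pow₂ p m n v = pow p (trunc m (suc n)) n v

gam : Ω
gam zero [] = true
gam (suc n) (false ∷ v) = gam n v
gam (suc n) (true ∷ v) = false

-- z_k = (z_k, γ^ℓ z_k), parametrised by ℓ = (k-1)/2 ∈ ℤ₂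
-- (k ∈ ℤ₂^× corresponds exactly to ℓ ∈ ℤ₂ via k = 1 + 2ℓ)
zP : ℤ₂ → Ω
zP l zero [] = false
zP l (suc n) (false ∷ v) = zP l n v
zP l (suc n) (true ∷ v) = pow₂ gam l n v xor zP l n (act (pow₂ gam l) v)

-- cyclic predecessor on Fin r (index 0 stands for a₁)
predc : ∀ {r} → Fin r → Fin r
predc {suc r} zero = fromℕ r
predc (suc j) = inject₁ j

-- generators: a₁ = (a_r, id)σ, a_i = (a_{i-1}, id)  (a_{i+1} is index i)
gen : (r : ℕ) → Fin r → Ω
gen r zero zero [] = true
gen r (suc i) zero [] = false
gen r i (suc n) (false ∷ v) = gen r (predc i) n v
gen r i (suc n) (true ∷ v) = false

-- group words in a₁..a_r (inj₁ i = a_i, inj₂ i = a_i⁻¹)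
Word : ℕ → Set
Word r = List (Fin r ⊎ Fin r)

letter : (r : ℕ) → Fin r ⊎ Fin r → Ω
letter r (inj₁ i) = gen r i
letter r (inj₂ i) = inv (gen r i)

evalW : (r : ℕ) → Word r → Ω
evalW r = foldr (λ l acc → letter r l · acc) e

-- agreement on the finite subtree T_n (same coset of the kernel of restriction to T_n)
AgreeOn : ℕ → Ω → Ω → Set
AgreeOn n p q = ∀ {j} → j ≤ n → (v : Vec Bool j) → act p v ≡ act q v

-- G = closure of ⟨a₁,…,a_r⟩
InG : (r : ℕ) → Ω → Set
InG r x = ∀ n → Σ (Word r) λ w → AgreeOn n (evalW r w) x

-- 𝒢 = G · N(γ),  N(γ) = {γ^m z_k}
In𝒢 : (r : ℕ) → Ω → Set
In𝒢 r x = Σ Ω λ g → InG r g × Σ ℤ₂ λ m → Σ ℤ₂ λ l → x ≈ (g · (pow₂ gam m · zP l))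

-- 𝒜 = {α z_k : α a word, k > 1 odd}, with k = 2ℓ+1, ℓ ≥ 1
In𝒜 : (r : ℕ) → Ω → Set
In𝒜 r x = Σ (Word r) λ w → Σ ℕ λ l → (1 ≤ l) × (x ≈ (evalW r w · zP (toℤ₂ l)))

DenseIn : (Ω → Set) → (Ω → Set) → Set
DenseIn A B = (∀ x → A x → B x) × (∀ x → B x → ∀ n → Σ Ω λ y → A y × AgreeOn n y x)

-- An element x = g γ^m z_ℓ of 𝒢 is a limit of elements of 𝒜 because the closure G contains γ,
-- hence γ^m, while z_ℓ agrees on T_n with z_L for the positive integer L = 2^n + (ℓ mod 2^n),
-- as z_ℓ restricted to T_n only depends on ℓ mod 2^n.  To reach γ, lift words along
-- a_i ↦ a_{i+1} (i < r), a_r ↦ a₁²: the lift of w is the element (w, a_r^c), c being the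
-- exponent sum of a_r in w.  Starting from a₁ ⋯ a_r and alternating lifting with right
-- multiplication by a₁⁻¹ keeps every exponent sum equal to 1, so the resulting words are
-- (w, id)σ for the previous word w, and they converge to γ = (γ, id)σ.
module Submission where

open import Defs
import Data.Integer.Properties as ℤ
open import Algebra.Properties.CommutativeSemigroup ℤ.+-commutativeSemigroup using (interchange)
open import Data.Bool using (Bool; true; false; _xor_; if_then_else_)
open import Data.Bool.Properties using (xor-assoc; xor-same; xor-identityʳ; xor-inverseˡ)
open import Data.Fin using (Fin; zero; suc; fromℕ; inject₁)
open import Data.Fin.Properties using (_≟_; fromℕ≢inject₁; inject₁-injective)
open import Data.Fin.Relation.Unary.Top using (view; ‵fromℕ; ‵inject₁)
open import Data.Integer using (ℤ; +_; -[1+_]; 0ℤ; 1ℤ; -1ℤ)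
  renaming (_+_ to _+ℤ_)
open import Data.List using ([]; _∷_; _++_; tabulate; concatMap)
open import Data.Nat using (ℕ; _≤_; zero; suc; _+_; _*_; _^_; _/_; _≡ᵇ_; _<_; z≤n; s≤s)
open import Data.Nat.Divisibility using (divides)
open import Data.Nat.DivMod using ([m+kn]%n≡m%n; +-distrib-/-∣ʳ; m*n/n≡m)
open import Data.Nat.Properties
  using (≤-trans; m≤n+m; m≤m*n; +-identityʳ; +-suc; <⇒≤; m<n⇒m<1+n; m<1+n⇒m<n∨m≡n)
open import Data.Product using (Σ; _×_; _,_)
open import Data.Sum using (_⊎_; inj₁; inj₂)
open import Data.Vec using (Vec; []; _∷_)
open import Function using (_∘_; id)
open import Relation.Binary.Bundles using (Setoid)
import Relation.Binary.Reasoning.Setoid as SetoidReasoning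
open import Relation.Binary.PropositionalEquality
open import Relation.Nullary.Decidable using (does; dec-true; dec-false; yes; no)

variable
  r j n : ℕ
  p p′ q q′ t A A′ B B′ C D : Ω
  τ : Bool
  ℓ ℓ′ : ℤ₂

xor-cancelʳ : ∀ x y → (x xor y) xor y ≡ x
xor-cancelʳ false y = xor-same y
xor-cancelʳ true y = xor-inverseˡ y

≈-refl : p ≈ p
≈-refl _ _ = refl

≈-sym : p ≈ q → q ≈ p
≈-sym p≈q n v = sym (p≈q n v)

≈-trans : p ≈ q → q ≈ t → p ≈ t
≈-trans p≈q q≈t n v = trans (p≈q n v) (q≈t n v)

≈-reflexive : p ≡ q → p ≈ q
≈-reflexive refl = ≈-refl

≈-setoid : Setoid _ _
≈-setoid = record
  { Carrier = Ω
  ; _≈_ = _≈_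
  ; isEquivalence = record { refl = ≈-refl ; sym = ≈-sym ; trans = ≈-trans }
  }

module ≈-Reasoning = SetoidReasoning ≈-setoid

act-≈ : p ≈ q → (v : Vec Bool n) → act p v ≡ act q v
act-≈ p≈q [] = refl
act-≈ p≈q (x ∷ v) =
  cong₂ _∷_ (cong (x xor_) (p≈q 0 [])) (act-≈ (λ n v → p≈q (suc n) (x ∷ v)) v)

act-e : (v : Vec Bool n) → act e v ≡ v
act-e [] = refl
act-e (x ∷ v) = cong₂ _∷_ (xor-identityʳ x) (act-e v)

act-· : ∀ p q (v : Vec Bool n) → act (p · q) v ≡ act q (act p v)
act-· p q [] = refl
act-· p q (x ∷ v) =
  cong₂ _∷_ (sym (xor-assoc x (p 0 []) (q 0 []))) (act-· (sec p x) (sec q (x xor p 0 [])) v)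

inv-act : ∀ p (v : Vec Bool n) → inv p n (act p v) ≡ p n v
inv-act p [] = refl
inv-act p (x ∷ v) =
  trans (cong (λ y → inv (sec p y) _ (act (sec p x) v)) (xor-cancelʳ x (p 0 [])))
        (inv-act (sec p x) v)

act-inv : ∀ p (v : Vec Bool n) → act p (act (inv p) v) ≡ v
act-inv p [] = refl
act-inv p (x ∷ v) = cong₂ _∷_ (xor-cancelʳ x (p 0 [])) (act-inv (sec p (x xor p 0 [])) v)

·-cong : p ≈ p′ → q ≈ q′ → (p · q) ≈ (p′ · q′)
·-cong {q = q} p≈p′ q≈q′ n v =
  cong₂ _xor_ (p≈p′ n v) (trans (cong (q n) (act-≈ p≈p′ v)) (q≈q′ n _))

·-congˡ : ∀ q → p ≈ p′ → (p · q) ≈ (p′ · q)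
·-congˡ q p≈p′ = ·-cong p≈p′ (≈-refl {q})

·-congʳ : ∀ p → q ≈ q′ → (p · q) ≈ (p · q′)
·-congʳ p q≈q′ = ·-cong (≈-refl {p}) q≈q′

·-assoc : ∀ p q t → ((p · q) · t) ≈ (p · (q · t))
·-assoc p q t n v =
  trans (xor-assoc (p n v) _ _) (cong (λ u → p n v xor (q n (act p v) xor t n u)) (act-· p q v))

·-identityˡ : ∀ p → (e · p) ≈ p
·-identityˡ p n v = cong (p n) (act-e v)

·-identityʳ : ∀ p → (p · e) ≈ p
·-identityʳ p n v = xor-identityʳ (p n v)

·-inverseʳ : ∀ p → (p · inv p) ≈ e
·-inverseʳ p n v = trans (cong (p n v xor_) (inv-act p v)) (xor-same (p n v))

·-inverseˡ : ∀ p → (inv p · p) ≈ e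
·-inverseˡ p n v = trans (cong (inv p n v xor_) label) (xor-same (inv p n v))
  where
  label : p n (act (inv p) v) ≡ inv p n v
  label = trans (sym (inv-act p (act (inv p) v))) (cong (inv p n) (act-inv p v))

inv-e : inv e ≈ e
inv-e zero [] = refl
inv-e (suc n) (x ∷ v) = inv-e n v

inv-cancelˡ : ∀ p q → (inv p · (p · q)) ≈ q
inv-cancelˡ p q = begin
  inv p · (p · q)  ≈⟨ ·-assoc (inv p) p q ⟨
  (inv p · p) · q  ≈⟨ ·-congˡ q (·-inverseˡ p) ⟩
  e · q            ≈⟨ ·-identityˡ q ⟩
  q                ∎
  where open ≈-Reasoning

inv-cancelʳ : ∀ p q → (p · (inv p · q)) ≈ q
inv-cancelʳ p q = begin
  p · (inv p · q)  ≈⟨ ·-assoc p (inv p) q ⟨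
  (p · inv p) · q  ≈⟨ ·-congˡ q (·-inverseʳ p) ⟩
  e · q            ≈⟨ ·-identityˡ q ⟩
  q                ∎
  where open ≈-Reasoning

pow-cong : p ≈ q → ∀ c → pow p c ≈ pow q c
pow-cong p≈q zero = ≈-refl
pow-cong p≈q (suc c) = ·-cong p≈q (pow-cong p≈q c)

pow-+ : ∀ p a b → pow p (a + b) ≈ (pow p a · pow p b)
pow-+ p zero b = ≈-sym (·-identityˡ (pow p b))
pow-+ p (suc a) b = ≈-trans (·-congʳ p (pow-+ p a b)) (≈-sym (·-assoc p (pow p a) (pow p b)))

pow-double : ∀ p c → pow p (c + c) ≈ pow (p · p) c
pow-double p zero = ≈-refl
pow-double p (suc c) = begin
  p · pow p (c + suc c)      ≡⟨ cong (λ k → p · pow p k) (+-suc c c) ⟩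
  p · (p · pow p (c + c))    ≈⟨ ·-congʳ p (·-congʳ p (pow-double p c)) ⟩
  p · (p · pow (p · p) c)    ≈⟨ ·-assoc p p (pow (p · p) c) ⟨
  (p · p) · pow (p · p) c    ∎
  where open ≈-Reasoning

infixr 25 _^ℤ_

_^ℤ_ : Ω → ℤ → Ω
p ^ℤ (+ c) = pow p c
p ^ℤ -[1+ c ] = pow (inv p) (suc c)

^ℤ-suc : ∀ p z → (p · p ^ℤ z) ≈ p ^ℤ (1ℤ +ℤ z)
^ℤ-suc p (+ c) = ≈-refl
^ℤ-suc p -[1+ zero ] = inv-cancelʳ p e
^ℤ-suc p -[1+ suc c ] = inv-cancelʳ p _

^ℤ-pred : ∀ p z → (inv p · p ^ℤ z) ≈ p ^ℤ (-1ℤ +ℤ z)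
^ℤ-pred p (+ zero) = ≈-refl
^ℤ-pred p (+ suc c) = inv-cancelˡ p _
^ℤ-pred p -[1+ c ] = ≈-refl

infix 25 ⟪_,_⟫_

⟪_,_⟫_ : Ω → Ω → Bool → Ω
(⟪ A , B ⟫ τ) zero [] = τ
(⟪ A , B ⟫ τ) (suc n) (false ∷ v) = A n v
(⟪ A , B ⟫ τ) (suc n) (true ∷ v) = B n v

⟪⟫-η : ∀ p → p ≈ ⟪ sec p false , sec p true ⟫ (p 0 [])
⟪⟫-η p zero [] = refl
⟪⟫-η p (suc n) (false ∷ v) = refl
⟪⟫-η p (suc n) (true ∷ v) = refl

⟪⟫-cong : A ≈ A′ → B ≈ B′ → ⟪ A , B ⟫ τ ≈ ⟪ A′ , B′ ⟫ τ
⟪⟫-cong A≈A′ B≈B′ zero [] = refl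
⟪⟫-cong A≈A′ B≈B′ (suc n) (false ∷ v) = A≈A′ n v
⟪⟫-cong A≈A′ B≈B′ (suc n) (true ∷ v) = B≈B′ n v

⟪⟫-· : (⟪ A , B ⟫ false · ⟪ C , D ⟫ τ) ≈ ⟪ A · C , B · D ⟫ τ
⟪⟫-· zero [] = refl
⟪⟫-· (suc n) (false ∷ v) = refl
⟪⟫-· (suc n) (true ∷ v) = refl

⟪⟫-swap-· : (⟪ A , B ⟫ true · ⟪ C , D ⟫ true) ≈ ⟪ A · D , B · C ⟫ false
⟪⟫-swap-· zero [] = refl
⟪⟫-swap-· (suc n) (false ∷ v) = refl
⟪⟫-swap-· (suc n) (true ∷ v) = refl

e-⟪⟫ : e ≈ ⟪ e , e ⟫ false
e-⟪⟫ = ⟪⟫-η e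

gam-⟪⟫ : gam ≈ ⟪ gam , e ⟫ true
gam-⟪⟫ = ⟪⟫-η gam

zP-⟪⟫ : zP ℓ ≈ ⟪ zP ℓ , pow₂ gam ℓ · zP ℓ ⟫ false
zP-⟪⟫ {ℓ} = ⟪⟫-η (zP ℓ)

infix 4 _≈[_]_

_≈[_]_ : Ω → ℕ → Ω → Set
p ≈[ n ] q = ∀ {j} → j < n → (v : Vec Bool j) → p j v ≡ q j v

≈⇒≈[] : p ≈ q → p ≈[ n ] q
≈⇒≈[] p≈q _ v = p≈q _ v

≈[]-refl : p ≈[ n ] p
≈[]-refl _ _ = refl

≈[]-resp-≈ : p ≈ p′ → p′ ≈[ n ] q′ → q′ ≈ q → p ≈[ n ] q
≈[]-resp-≈ p≈p′ p′≈q′ q′≈q j<n v = trans (p≈p′ _ v) (trans (p′≈q′ j<n v) (q′≈q _ v))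

≈[]⇒AgreeOn : p ≈[ n ] q → AgreeOn n p q
≈[]⇒AgreeOn p≈q z≤n [] = refl
≈[]⇒AgreeOn p≈q (s≤s j≤n) (x ∷ v) =
  cong₂ _∷_ (cong (x xor_) (p≈q (s≤s z≤n) []))
            (≈[]⇒AgreeOn (λ j<n v → p≈q (s≤s j<n) (x ∷ v)) j≤n v)

≈[]-· : p ≈[ n ] p′ → q ≈[ n ] q′ → p · q ≈[ n ] p′ · q′
≈[]-· {q = q} p≈p′ q≈q′ j<n v =
  cong₂ _xor_ (p≈p′ j<n v) (trans (cong (q _) (≈[]⇒AgreeOn p≈p′ (<⇒≤ j<n) v)) (q≈q′ j<n _))

≈[]-⟪⟫ : A ≈[ n ] C → B ≈[ n ] D → ⟪ A , B ⟫ τ ≈[ suc n ] ⟪ C , D ⟫ τ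
≈[]-⟪⟫ A≈C B≈D {zero} _ [] = refl
≈[]-⟪⟫ A≈C B≈D {suc j} (s≤s j<n) (false ∷ v) = A≈C j<n v
≈[]-⟪⟫ A≈C B≈D {suc j} (s≤s j<n) (true ∷ v) = B≈D j<n v

≈⇒AgreeOn : p ≈ q → AgreeOn n p q
≈⇒AgreeOn p≈q _ = act-≈ p≈q

AgreeOn-trans : AgreeOn n p q → AgreeOn n q t → AgreeOn n p t
AgreeOn-trans p≈q q≈t j≤n v = trans (p≈q j≤n v) (q≈t j≤n v)

AgreeOn-· : AgreeOn n p p′ → AgreeOn n q q′ → AgreeOn n (p · q) (p′ · q′)
AgreeOn-· {p = p} {p′} {q} {q′} p≈p′ q≈q′ j≤n v = begin
  act (p · q) v     ≡⟨ act-· p q v ⟩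
  act q (act p v)   ≡⟨ cong (act q) (p≈p′ j≤n v) ⟩
  act q (act p′ v)  ≡⟨ q≈q′ j≤n (act p′ v) ⟩
  act q′ (act p′ v) ≡⟨ act-· p′ q′ v ⟨
  act (p′ · q′) v   ∎
  where open ≡-Reasoning

gam·gam-⟪⟫ : (gam · gam) ≈ ⟪ gam , gam ⟫ false
gam·gam-⟪⟫ = begin
  gam · gam                             ≈⟨ ·-cong gam-⟪⟫ gam-⟪⟫ ⟩
  ⟪ gam , e ⟫ true · ⟪ gam , e ⟫ true  ≈⟨ ⟪⟫-swap-· ⟩
  ⟪ gam · e , e · gam ⟫ false           ≈⟨ ⟪⟫-cong (·-identityʳ gam) (·-identityˡ gam) ⟩
  ⟪ gam , gam ⟫ false                   ∎
  where open ≈-Reasoning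

pow-⟪⟫ : ∀ c → pow (⟪ A , B ⟫ false) c ≈ ⟪ pow A c , pow B c ⟫ false
pow-⟪⟫ zero = e-⟪⟫
pow-⟪⟫ {A} {B} (suc c) = ≈-trans (·-congʳ (⟪ A , B ⟫ false) (pow-⟪⟫ c)) ⟪⟫-·

pow-gam-2^≈[]e : ∀ k → pow gam (2 ^ k) ≈[ k ] e
pow-gam-2^≈[]e zero = λ ()
pow-gam-2^≈[]e (suc k) =
  ≈[]-resp-≈ square (≈[]-⟪⟫ (pow-gam-2^≈[]e k) (pow-gam-2^≈[]e k)) (≈-sym e-⟪⟫)
  where
  open ≈-Reasoning
  square : pow gam (2 ^ suc k) ≈ ⟪ pow gam (2 ^ k) , pow gam (2 ^ k) ⟫ false
  square = begin
    pow gam (2 ^ k + (2 ^ k + 0))                 ≡⟨ cong (pow gam ∘ _+_ (2 ^ k)) (+-identityʳ (2 ^ k)) ⟩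
    pow gam (2 ^ k + 2 ^ k)                       ≈⟨ pow-double gam (2 ^ k) ⟩
    pow (gam · gam) (2 ^ k)                       ≈⟨ pow-cong gam·gam-⟪⟫ (2 ^ k) ⟩
    pow (⟪ gam , gam ⟫ false) (2 ^ k)             ≈⟨ pow-⟪⟫ (2 ^ k) ⟩
    ⟪ pow gam (2 ^ k) , pow gam (2 ^ k) ⟫ false  ∎

pow-+2^ : pow p (2 ^ j) ≈[ j ] e → ∀ a → pow p (a + 2 ^ j) ≈[ j ] pow p a
pow-+2^ {p} {j} p²ʲ≈e a =
  ≈[]-resp-≈ (pow-+ p a (2 ^ j)) (≈[]-· (≈[]-refl {pow p a}) p²ʲ≈e) (·-identityʳ (pow p a))

pow-trunc : (∀ j → pow p (2 ^ j) ≈[ j ] e) → ∀ m n → pow p (trunc m n) ≈[ n ] pow₂ p m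
pow-trunc p²ʲ≈e m zero = λ ()
pow-trunc {p} p²ʲ≈e m (suc n) {j} j<1+n v with m<1+n⇒m<n∨m≡n j<1+n
... | inj₁ j<n = trans (pow-trunc-suc j<n v) (pow-trunc p²ʲ≈e m n j<n v)
  where
  pow-trunc-suc : pow p (trunc m (suc n)) ≈[ n ] pow p (trunc m n)
  pow-trunc-suc with m n
  ... | true = pow-+2^ (p²ʲ≈e n) (trunc m n)
  ... | false = ≈⇒≈[] (≈-reflexive (cong (pow p) (+-identityʳ (trunc m n))))
... | inj₂ refl = refl

infix 4 _≡[_]_

_≡[_]_ : ℤ₂ → ℕ → ℤ₂ → Set
ℓ ≡[ n ] ℓ′ = ∀ {i} → i < n → ℓ i ≡ ℓ′ i

trunc-cong : ℓ ≡[ n ] ℓ′ → ∀ {k} → k ≤ n → trunc ℓ k ≡ trunc ℓ′ k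
trunc-cong ℓ≡ℓ′ {zero} _ = refl
trunc-cong ℓ≡ℓ′ {suc k} k<n =
  cong₂ _+_ (trunc-cong ℓ≡ℓ′ (<⇒≤ k<n)) (cong (λ b → if b then 2 ^ k else 0) (ℓ≡ℓ′ k<n))

pow₂-cong : ∀ p → ℓ ≡[ n ] ℓ′ → pow₂ p ℓ ≈[ n ] pow₂ p ℓ′
pow₂-cong p ℓ≡ℓ′ {j} j<n v = cong (λ c → pow p c j v) (trunc-cong ℓ≡ℓ′ j<n)

zP-cong : ∀ n → ℓ ≡[ n ] ℓ′ → zP ℓ ≈[ n ] zP ℓ′
zP-cong zero _ = λ ()
zP-cong {ℓ = ℓ} {ℓ′} (suc n) ℓ≡ℓ′ =
  ≈[]-resp-≈ zP-⟪⟫ (≈[]-⟪⟫ zP≈zP′ (≈[]-· (pow₂-cong gam ℓ≡ℓ′ₙ) zP≈zP′)) (≈-sym zP-⟪⟫)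
  where
  ℓ≡ℓ′ₙ : ℓ ≡[ n ] ℓ′
  ℓ≡ℓ′ₙ i<n = ℓ≡ℓ′ (m<n⇒m<1+n i<n)
  zP≈zP′ : zP ℓ ≈[ n ] zP ℓ′
  zP≈zP′ = zP-cong n ℓ≡ℓ′ₙ

pow₂-zero : ∀ p → pow₂ p (λ _ → false) ≈ e
pow₂-zero p n v = cong (λ c → pow p c n v) (trunc-zero (suc n))
  where
  trunc-zero : ∀ k → trunc (λ _ → false) k ≡ 0
  trunc-zero zero = refl
  trunc-zero (suc k) = cong (_+ 0) (trunc-zero k)

bit : Bool → ℕ
bit false = 0
bit true = 1

toℤ₂-head : ∀ b x → toℤ₂ (bit b + x * 2) 0 ≡ b
toℤ₂-head false x = cong (_≡ᵇ 1) ([m+kn]%n≡m%n 0 x 2)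
toℤ₂-head true x = cong (_≡ᵇ 1) ([m+kn]%n≡m%n 1 x 2)

toℤ₂-tail : ∀ b x i → toℤ₂ (bit b + x * 2) (suc i) ≡ toℤ₂ x i
toℤ₂-tail b x i = cong (λ y → toℤ₂ y i) (half b)
  where
  half : ∀ b → (bit b + x * 2) / 2 ≡ x
  half false = m*n/n≡m x 2
  half true = trans (+-distrib-/-∣ʳ 1 {x * 2} {2} (divides x refl)) (m*n/n≡m x 2)

-- 2^n + (ℓ mod 2^n)
positiveRep : ℤ₂ → ℕ → ℕ
positiveRep ℓ zero = 1
positiveRep ℓ (suc n) = bit (ℓ 0) + positiveRep (ℓ ∘ suc) n * 2

positiveRep-positive : ∀ ℓ n → 1 ≤ positiveRep ℓ n
positiveRep-positive ℓ zero = s≤s z≤n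
positiveRep-positive ℓ (suc n) =
  ≤-trans (positiveRep-positive (ℓ ∘ suc) n) (≤-trans (m≤m*n _ 2) (m≤n+m _ (bit (ℓ 0))))

toℤ₂-positiveRep : ∀ ℓ n → toℤ₂ (positiveRep ℓ n) ≡[ n ] ℓ
toℤ₂-positiveRep ℓ (suc n) {zero} _ = toℤ₂-head (ℓ 0) (positiveRep (ℓ ∘ suc) n)
toℤ₂-positiveRep ℓ (suc n) {suc i} (s≤s i<n) =
  trans (toℤ₂-tail (ℓ 0) (positiveRep (ℓ ∘ suc) n) i) (toℤ₂-positiveRep (ℓ ∘ suc) n i<n)

evalW-++ : ∀ r (u w : Word r) → evalW r (u ++ w) ≈ (evalW r u · evalW r w)
evalW-++ r [] w = ≈-sym (·-identityˡ (evalW r w))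
evalW-++ r (l ∷ u) w =
  ≈-trans (·-congʳ (letter r l) (evalW-++ r u w))
          (≈-sym (·-assoc (letter r l) (evalW r u) (evalW r w)))

evalW∈G : ∀ r (w : Word r) → InG r (evalW r w)
evalW∈G r w n = w , λ _ _ → refl

InG-· : InG r p → InG r q → InG r (p · q)
InG-· {r} p∈G q∈G n =
  let (u , u≈p) = p∈G n
      (w , w≈q) = q∈G n
  in u ++ w , AgreeOn-trans (≈⇒AgreeOn (evalW-++ r u w)) (AgreeOn-· u≈p w≈q)

InG-pow : InG r p → ∀ c → InG r (pow p c)
InG-pow {r} p∈G zero = evalW∈G r []
InG-pow p∈G (suc c) = InG-· p∈G (InG-pow p∈G c)

InG-closed : (∀ n → Σ Ω λ q → InG r q × AgreeOn n q p) → InG r p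
InG-closed approx n =
  let (q , q∈G , q≈p) = approx n
      (w , w≈q) = q∈G n
  in w , AgreeOn-trans w≈q q≈p

exponent : Fin r → Fin r ⊎ Fin r → ℤ
exponent i (inj₁ k) = if does (k ≟ i) then 1ℤ else 0ℤ
exponent i (inj₂ k) = if does (k ≟ i) then -1ℤ else 0ℤ

exponentSum : Fin r → Word r → ℤ
exponentSum i [] = 0ℤ
exponentSum i (l ∷ w) = exponent i l +ℤ exponentSum i w

exponentSum-++ : ∀ i (u w : Word r) → exponentSum i (u ++ w) ≡ exponentSum i u +ℤ exponentSum i w
exponentSum-++ i [] w = sym (ℤ.+-identityˡ (exponentSum i w))
exponentSum-++ i (l ∷ u) w =
  trans (cong (exponent i l +ℤ_) (exponentSum-++ i u w)) (sym (ℤ.+-assoc (exponent i l) _ _))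

^ℤ-exponent : ∀ p (i : Fin r) l z → (p ^ℤ exponent i l · p ^ℤ z) ≈ p ^ℤ (exponent i l +ℤ z)
^ℤ-exponent p i (inj₁ k) z with does (k ≟ i)
... | true = ≈-trans (·-congˡ (p ^ℤ z) (·-identityʳ p)) (^ℤ-suc p z)
... | false = ≈-trans (·-identityˡ (p ^ℤ z)) (≈-reflexive (cong (p ^ℤ_) (sym (ℤ.+-identityˡ z))))
^ℤ-exponent p i (inj₂ k) z with does (k ≟ i)
... | true = ≈-trans (·-congˡ (p ^ℤ z) (·-identityʳ (inv p))) (^ℤ-pred p z)
... | false = ≈-trans (·-identityˡ (p ^ℤ z)) (≈-reflexive (cong (p ^ℤ_) (sym (ℤ.+-identityˡ z))))

generators : ∀ r → Word r
generators r = tabulate inj₁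

exponentSum-tabulate-suc : ∀ {m} i (f : Fin m → Fin r) →
  exponentSum (suc i) (tabulate (λ k → inj₁ (suc (f k))))
    ≡ exponentSum i (tabulate (λ k → inj₁ (f k)))
exponentSum-tabulate-suc {m = zero} i f = refl
exponentSum-tabulate-suc {m = suc m} i f =
  cong (exponent i (inj₁ (f zero)) +ℤ_) (exponentSum-tabulate-suc i (f ∘ suc))

exponentSum-tabulate-zero : ∀ {m} (f : Fin m → Fin r) →
  exponentSum zero (tabulate (λ k → inj₁ (suc (f k)))) ≡ 0ℤ
exponentSum-tabulate-zero {m = zero} f = refl
exponentSum-tabulate-zero {m = suc m} f = cong (0ℤ +ℤ_) (exponentSum-tabulate-zero (f ∘ suc))

exponentSum-generators : (i : Fin r) → exponentSum i (generators r) ≡ 1ℤ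
exponentSum-generators {suc r} zero = cong (1ℤ +ℤ_) (exponentSum-tabulate-zero {r = r} id)
exponentSum-generators (suc i) =
  cong (0ℤ +ℤ_) (trans (exponentSum-tabulate-suc i id) (exponentSum-generators i))

does-≟-refl : (i : Fin r) → does (i ≟ i) ≡ true
does-≟-refl i = dec-true (i ≟ i) refl

does-inject₁≟fromℕ : (i : Fin r) → does (inject₁ i ≟ fromℕ r) ≡ false
does-inject₁≟fromℕ i = dec-false (inject₁ i ≟ _) (fromℕ≢inject₁ ∘ sym)

does-fromℕ≟inject₁ : (i : Fin r) → does (fromℕ r ≟ inject₁ i) ≡ false
does-fromℕ≟inject₁ i = dec-false (_ ≟ inject₁ i) fromℕ≢inject₁

does-inject₁≟inject₁ : (i k : Fin r) → does (inject₁ i ≟ inject₁ k) ≡ does (i ≟ k)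
does-inject₁≟inject₁ i k with i ≟ k
... | yes refl = dec-true (inject₁ i ≟ inject₁ i) refl
... | no i≢k = dec-false (inject₁ i ≟ inject₁ k) (i≢k ∘ inject₁-injective)

module Odometer (s : ℕ) where

  a₁ aᵣ : Ω
  a₁ = gen (suc s) zero
  aᵣ = gen (suc s) (fromℕ s)

  a₁-⟪⟫ : a₁ ≈ ⟪ aᵣ , e ⟫ true
  a₁-⟪⟫ = ⟪⟫-η a₁

  a₁⁻¹-⟪⟫ : inv a₁ ≈ ⟪ inv e , inv aᵣ ⟫ true
  a₁⁻¹-⟪⟫ = ⟪⟫-η (inv a₁)

  a-suc-⟪⟫ : ∀ i → gen (suc s) (suc i) ≈ ⟪ gen (suc s) (inject₁ i) , e ⟫ false
  a-suc-⟪⟫ i = ⟪⟫-η (gen (suc s) (suc i))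

  a-suc⁻¹-⟪⟫ : ∀ i → inv (gen (suc s) (suc i)) ≈ ⟪ inv (gen (suc s) (inject₁ i)) , inv e ⟫ false
  a-suc⁻¹-⟪⟫ i = ⟪⟫-η (inv (gen (suc s) (suc i)))

  liftLetter : Fin (suc s) ⊎ Fin (suc s) → Word (suc s)
  liftLetter (inj₁ i) with view i
  ... | ‵fromℕ = inj₁ zero ∷ inj₁ zero ∷ []
  ... | ‵inject₁ k = inj₁ (suc k) ∷ []
  liftLetter (inj₂ i) with view i
  ... | ‵fromℕ = inj₂ zero ∷ inj₂ zero ∷ []
  ... | ‵inject₁ k = inj₂ (suc k) ∷ []

  lift : Word (suc s) → Word (suc s)
  lift = concatMap liftLetter

  evalW-liftLetter : ∀ l →
    evalW (suc s) (liftLetter l) ≈ ⟪ letter (suc s) l , aᵣ ^ℤ exponent (fromℕ s) l ⟫ false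
  evalW-liftLetter (inj₁ i) with view i
  ... | ‵fromℕ rewrite does-≟-refl (fromℕ s) = begin
    a₁ · (a₁ · e)                       ≈⟨ ·-congʳ a₁ (·-identityʳ a₁) ⟩
    a₁ · a₁                             ≈⟨ ·-cong a₁-⟪⟫ a₁-⟪⟫ ⟩
    ⟪ aᵣ , e ⟫ true · ⟪ aᵣ , e ⟫ true  ≈⟨ ⟪⟫-swap-· ⟩
    ⟪ aᵣ · e , e · aᵣ ⟫ false           ≈⟨ ⟪⟫-cong (·-identityʳ aᵣ) (·-identityˡ aᵣ) ⟩
    ⟪ aᵣ , aᵣ ⟫ false                   ≈⟨ ⟪⟫-cong ≈-refl (≈-sym (·-identityʳ aᵣ)) ⟩
    ⟪ aᵣ , aᵣ · e ⟫ false               ∎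
    where open ≈-Reasoning
  ... | ‵inject₁ k rewrite does-inject₁≟fromℕ k =
    ≈-trans (·-identityʳ (gen (suc s) (suc k))) (a-suc-⟪⟫ k)
  evalW-liftLetter (inj₂ i) with view i
  ... | ‵fromℕ rewrite does-≟-refl (fromℕ s) = begin
    inv a₁ · (inv a₁ · e)                               ≈⟨ ·-congʳ (inv a₁) (·-identityʳ (inv a₁)) ⟩
    inv a₁ · inv a₁                                     ≈⟨ ·-cong a₁⁻¹-⟪⟫ a₁⁻¹-⟪⟫ ⟩
    ⟪ inv e , inv aᵣ ⟫ true · ⟪ inv e , inv aᵣ ⟫ true  ≈⟨ ⟪⟫-swap-· ⟩
    ⟪ inv e · inv aᵣ , inv aᵣ · inv e ⟫ false           ≈⟨ ⟪⟫-cong (·-congˡ (inv aᵣ) inv-e)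
                                                                    (·-congʳ (inv aᵣ) inv-e) ⟩
    ⟪ e · inv aᵣ , inv aᵣ · e ⟫ false                   ≈⟨ ⟪⟫-cong (·-identityˡ (inv aᵣ)) ≈-refl ⟩
    ⟪ inv aᵣ , inv aᵣ · e ⟫ false                       ∎
    where open ≈-Reasoning
  ... | ‵inject₁ k rewrite does-inject₁≟fromℕ k =
    ≈-trans (·-identityʳ (inv (gen (suc s) (suc k))))
            (≈-trans (a-suc⁻¹-⟪⟫ k) (⟪⟫-cong ≈-refl inv-e))

  evalW-lift : ∀ w →
    evalW (suc s) (lift w) ≈ ⟪ evalW (suc s) w , aᵣ ^ℤ exponentSum (fromℕ s) w ⟫ false
  evalW-lift [] = e-⟪⟫
  evalW-lift (l ∷ w) = begin
    evalW (suc s) (liftLetter l ++ lift w)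
      ≈⟨ evalW-++ (suc s) (liftLetter l) (lift w) ⟩
    evalW (suc s) (liftLetter l) · evalW (suc s) (lift w)
      ≈⟨ ·-cong (evalW-liftLetter l) (evalW-lift w) ⟩
    ⟪ letter (suc s) l , aᵣ ^ℤ x ⟫ false · ⟪ evalW (suc s) w , aᵣ ^ℤ y ⟫ false
      ≈⟨ ⟪⟫-· ⟩
    ⟪ letter (suc s) l · evalW (suc s) w , aᵣ ^ℤ x · aᵣ ^ℤ y ⟫ false
      ≈⟨ ⟪⟫-cong ≈-refl (^ℤ-exponent aᵣ (fromℕ s) l y) ⟩
    ⟪ letter (suc s) l · evalW (suc s) w , aᵣ ^ℤ (x +ℤ y) ⟫ false
      ∎
    where
    open ≈-Reasoning
    x = exponent (fromℕ s) l
    y = exponentSum (fromℕ s) w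

  exponentSum-liftLetter-zero : ∀ l →
    exponentSum zero (liftLetter l) ≡ exponent (fromℕ s) l +ℤ exponent (fromℕ s) l
  exponentSum-liftLetter-zero (inj₁ i) with view i
  ... | ‵fromℕ rewrite does-≟-refl (fromℕ s) = refl
  ... | ‵inject₁ k rewrite does-inject₁≟fromℕ k = refl
  exponentSum-liftLetter-zero (inj₂ i) with view i
  ... | ‵fromℕ rewrite does-≟-refl (fromℕ s) = refl
  ... | ‵inject₁ k rewrite does-inject₁≟fromℕ k = refl

  exponentSum-liftLetter-suc : ∀ j l → exponentSum (suc j) (liftLetter l) ≡ exponent (inject₁ j) l
  exponentSum-liftLetter-suc j (inj₁ i) with view i
  ... | ‵fromℕ rewrite does-fromℕ≟inject₁ j = refl
  ... | ‵inject₁ k rewrite does-inject₁≟inject₁ k j = ℤ.+-identityʳ _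
  exponentSum-liftLetter-suc j (inj₂ i) with view i
  ... | ‵fromℕ rewrite does-fromℕ≟inject₁ j = refl
  ... | ‵inject₁ k rewrite does-inject₁≟inject₁ k j = ℤ.+-identityʳ _

  exponentSum-lift-zero : ∀ w →
    exponentSum zero (lift w) ≡ exponentSum (fromℕ s) w +ℤ exponentSum (fromℕ s) w
  exponentSum-lift-zero [] = refl
  exponentSum-lift-zero (l ∷ w) = begin
    exponentSum zero (liftLetter l ++ lift w)
      ≡⟨ exponentSum-++ zero (liftLetter l) (lift w) ⟩
    exponentSum zero (liftLetter l) +ℤ exponentSum zero (lift w)
      ≡⟨ cong₂ _+ℤ_ (exponentSum-liftLetter-zero l) (exponentSum-lift-zero w) ⟩
    (x +ℤ x) +ℤ (y +ℤ y)
      ≡⟨ interchange x x y y ⟩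
    (x +ℤ y) +ℤ (x +ℤ y)
      ∎
    where
    open ≡-Reasoning
    x = exponent (fromℕ s) l
    y = exponentSum (fromℕ s) w

  exponentSum-lift-suc : ∀ j w → exponentSum (suc j) (lift w) ≡ exponentSum (inject₁ j) w
  exponentSum-lift-suc j [] = refl
  exponentSum-lift-suc j (l ∷ w) =
    trans (exponentSum-++ (suc j) (liftLetter l) (lift w))
          (cong₂ _+ℤ_ (exponentSum-liftLetter-suc j l) (exponentSum-lift-suc j w))

  gamWord : ℕ → Word (suc s)
  gamWord zero = generators (suc s)
  gamWord (suc n) = lift (gamWord n) ++ inj₂ zero ∷ []

  exponentSum-gamWord : ∀ n i → exponentSum i (gamWord n) ≡ 1ℤ
  exponentSum-gamWord zero i = exponentSum-generators i
  exponentSum-gamWord (suc n) zero = begin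
    exponentSum zero (lift (gamWord n) ++ inj₂ zero ∷ [])
      ≡⟨ exponentSum-++ zero (lift (gamWord n)) (inj₂ zero ∷ []) ⟩
    exponentSum zero (lift (gamWord n)) +ℤ -1ℤ
      ≡⟨ cong (_+ℤ -1ℤ) (exponentSum-lift-zero (gamWord n)) ⟩
    (x +ℤ x) +ℤ -1ℤ
      ≡⟨ cong (λ x → (x +ℤ x) +ℤ -1ℤ) (exponentSum-gamWord n (fromℕ s)) ⟩
    1ℤ
      ∎
    where
    open ≡-Reasoning
    x = exponentSum (fromℕ s) (gamWord n)
  exponentSum-gamWord (suc n) (suc j) = begin
    exponentSum (suc j) (lift (gamWord n) ++ inj₂ zero ∷ [])
      ≡⟨ exponentSum-++ (suc j) (lift (gamWord n)) (inj₂ zero ∷ []) ⟩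
    exponentSum (suc j) (lift (gamWord n)) +ℤ 0ℤ
      ≡⟨ cong (_+ℤ 0ℤ) (exponentSum-lift-suc j (gamWord n)) ⟩
    exponentSum (inject₁ j) (gamWord n) +ℤ 0ℤ
      ≡⟨ cong (_+ℤ 0ℤ) (exponentSum-gamWord n (inject₁ j)) ⟩
    1ℤ
      ∎
    where open ≡-Reasoning

  gamWord-⟪⟫ : ∀ n → evalW (suc s) (gamWord (suc n)) ≈ ⟪ evalW (suc s) (gamWord n) , e ⟫ true
  gamWord-⟪⟫ n = begin
    evalW (suc s) (lift (gamWord n) ++ inj₂ zero ∷ [])
      ≈⟨ evalW-++ (suc s) (lift (gamWord n)) (inj₂ zero ∷ []) ⟩
    evalW (suc s) (lift (gamWord n)) · (inv a₁ · e)
      ≈⟨ ·-cong (evalW-lift (gamWord n)) (≈-trans (·-identityʳ (inv a₁)) a₁⁻¹-⟪⟫) ⟩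
    ⟪ w , aᵣ ^ℤ exponentSum (fromℕ s) (gamWord n) ⟫ false · ⟪ inv e , inv aᵣ ⟫ true
      ≡⟨ cong (λ c → ⟪ w , aᵣ ^ℤ c ⟫ false · ⟪ inv e , inv aᵣ ⟫ true)
              (exponentSum-gamWord n (fromℕ s)) ⟩
    ⟪ w , aᵣ · e ⟫ false · ⟪ inv e , inv aᵣ ⟫ true
      ≈⟨ ⟪⟫-· ⟩
    ⟪ w · inv e , (aᵣ · e) · inv aᵣ ⟫ true
      ≈⟨ ⟪⟫-cong (≈-trans (·-congʳ w inv-e) (·-identityʳ w))
                 (≈-trans (·-congˡ (inv aᵣ) (·-identityʳ aᵣ)) (·-inverseʳ aᵣ)) ⟩
    ⟪ w , e ⟫ true
      ∎
    where
    open ≈-Reasoning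
    w = evalW (suc s) (gamWord n)

  gamWord≈[]gam : ∀ n → evalW (suc s) (gamWord n) ≈[ n ] gam
  gamWord≈[]gam zero = λ ()
  gamWord≈[]gam (suc n) =
    ≈[]-resp-≈ (gamWord-⟪⟫ n) (≈[]-⟪⟫ (gamWord≈[]gam n) ≈[]-refl) (≈-sym gam-⟪⟫)

  gam∈G : InG (suc s) gam
  gam∈G n = gamWord n , ≈[]⇒AgreeOn (gamWord≈[]gam n)

  pow₂-gam∈G : ∀ m → InG (suc s) (pow₂ gam m)
  pow₂-gam∈G m = InG-closed λ n →
    pow gam (trunc m n) , InG-pow gam∈G (trunc m n) , ≈[]⇒AgreeOn (pow-trunc pow-gam-2^≈[]e m n)

𝒜⊆𝒢 : ∀ r x → In𝒜 r x → In𝒢 r x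
𝒜⊆𝒢 r x (w , L , _ , x≈wz) =
  evalW r w , evalW∈G r w , (λ _ → false) , toℤ₂ L ,
  ≈-trans x≈wz (·-congʳ (evalW r w) (≈-sym γ⁰z≈z))
  where
  γ⁰z≈z : (pow₂ gam (λ _ → false) · zP (toℤ₂ L)) ≈ zP (toℤ₂ L)
  γ⁰z≈z = ≈-trans (·-congˡ (zP (toℤ₂ L)) (pow₂-zero gam)) (·-identityˡ (zP (toℤ₂ L)))

𝒢⊆closure-𝒜 : ∀ s x → In𝒢 (suc s) x → ∀ n → Σ Ω λ y → In𝒜 (suc s) y × AgreeOn n y x
𝒢⊆closure-𝒜 s x (g , g∈G , m , ℓ , x≈gγz) n =
  let (w , w≈gγ) = InG-· g∈G (Odometer.pow₂-gam∈G s m) n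
      L = positiveRep ℓ n
  in evalW (suc s) w · zP (toℤ₂ L) ,
     (w , L , positiveRep-positive ℓ n , ≈-refl) ,
     AgreeOn-trans (AgreeOn-· w≈gγ (≈[]⇒AgreeOn (zP-cong n (toℤ₂-positiveRep ℓ n))))
                   (≈⇒AgreeOn (≈-trans (·-assoc g (pow₂ gam m) (zP ℓ)) (≈-sym x≈gγz)))

-- The argument works for every r ≥ 1.
proposition7p1 : (r : ℕ) → 2 ≤ r → DenseIn (In𝒜 r) (In𝒢 r)
proposition7p1 zero ()
proposition7p1 (suc s) _ = 𝒜⊆𝒢 (suc s) , 𝒢⊆closure-𝒜 s
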